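{- Let $k>2$ be a prime such that $2^k-1$ is prime. Let $n = 2^{\alpha-1}p$, where $\alpha>1$ is an integer and $p$ is an odd prime with $p<3\cdot 2^{\alpha-1}-1$. Then $n$ divides $\sigma_k(n)$ if and only if $n$ is an even perfect number and $n\neq 2^{k-1}(2^k-1)$.
   Context: For a positive integer $n$ and integer $k\ge 1$, $\sigma_k(n)=\sum_{d\mid n} d^k$, the sum over positive divisors $d$ of $n$. A positive integer $n$ is perfect if $\sigma_1(n)=2n$. -}

module Defs where

open import Data.Nat using (ℕ; suc; _+_; _*_; _^_)
open import Data.Nat.Divisibility using (_∣_; _∣?_)
open import Data.List using (List; filter; map; upTo)
open import Data.Nat.ListAction using (sum)
open import Relation.Binary.PropositionalEquality using (_≡_)
open import Data.Product using (_×_)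

-- positive divisors of n: those d ∈ {1,…,n} with d ∣ n  (for n = 0 this is empty;
-- the statement only uses n ≥ 1)
divisors : ℕ → List ℕ
divisors n = filter (λ d → d ∣? n) (map suc (upTo n))

σ : ℕ → ℕ → ℕ
σ k n = sum (map (λ d → d ^ k) (divisors n))

Perfect : ℕ → Set
Perfect n = (1 Data.Nat.≤ n) × (σ 1 n ≡ 2 * n)

module Submission where

-- Write n = 2^m·p with m = α − 1 ≥ 1 and p an odd prime.  Listing the divisors of n
-- gives σ_k(n) = S·(1 + p^k) with S = 1 + 2^k + ⋯ + 2^(km) odd.  As p ∤ 1 + p^k,
-- n ∣ σ_k(n) iff 2^m ∣ 1 + p^k and p ∣ S.  For odd k, 1 + p^k = (1 + p)·(odd), so the
-- first condition is 2^m ∣ 1 + p, and the bound leaves p + 1 ∈ {2^m, 2^(m+1)}: p is a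
-- Mersenne prime.  Because 2 has order a modulo 2^a − 1 and S ≡ m + 1 (mod 2^k − 1),
-- p + 1 = 2^m is impossible, while for p + 1 = 2^(m+1) we get p ∣ S iff m + 1 ≠ k.
-- On the other side, 2^m·p is perfect iff p + 1 = 2^(m+1), and then it equals
-- 2^(k−1)(2^k − 1) iff m + 1 = k.  So both sides mean "p + 1 = 2^(m+1) and m + 1 ≠ k".

open import Defs
open import Data.Nat using (ℕ; zero; suc; pred; z<s; s<s⁻¹; ≢-nonZero⁻¹; >-nonZero; _+_; _*_; _∸_; _^_; _<_; _≤_; z≤n; s≤s; NonZero; nonTrivial⇒n>1)
open import Data.Nat.Properties
open import Data.Nat.Divisibility
open import Data.Nat.DivMod using (_%_; _/_; m≡m%n+[m/n]*n; m%n<n)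
open import Data.Nat.Primality using (Prime; prime[2]; prime⇒irreducible; prime⇒nonTrivial; prime⇒nonZero; euclidsLemma)
open import Data.Nat.Coprimality using (Coprime; coprime-divisor)
open import Data.Nat.ListAction using (sum)
open import Data.Nat.ListAction.Properties using (sum-↭)
open import Data.Nat.Solver using (module +-*-Solver)
open import Data.List using (List; []; _∷_; map; upTo)
open import Data.List.Membership.Propositional using (_∈_)
open import Data.List.Membership.Propositional.Properties using (∈-filter⁺; ∈-filter⁻; ∈-map⁺; ∈-upTo⁺)
open import Data.List.Membership.Propositional.Properties.WithK using (unique∧set⇒bag)
open import Data.List.Relation.Unary.Any using (here; there)
open import Data.List.Relation.Unary.All using (tabulate; []; _∷_)
open import Data.List.Relation.Unary.AllPairs using ([]; _∷_)
open import Data.List.Relation.Unary.Unique.Propositional using (Unique)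
import Data.List.Relation.Unary.Unique.Propositional.Properties as Unique
open import Data.List.Relation.Binary.BagAndSetEquality using (∼bag⇒↭)
open import Data.List.Relation.Binary.Permutation.Propositional using (_↭_)
import Data.List.Relation.Binary.Permutation.Propositional.Properties as Perm
open import Data.Product using (_×_; _,_; proj₁; proj₂; ∃-syntax)
open import Data.Sum using (_⊎_; inj₁; inj₂; [_,_]′)
open import Data.Empty using (⊥-elim)
open import Function using (_∘_; id)
open import Function.Bundles using (_⇔_; mk⇔; Equivalence)
import Function.Properties.Equivalence as ⇔
open import Relation.Binary.PropositionalEquality
open import Relation.Nullary using (¬_; yes; no)

open +-*-Solver
open Equivalence using (to; from)

prime>1 : ∀ {p} → Prime p → 1 < p
prime>1 {p} pp = nonTrivial⇒n>1 p {{prime⇒nonTrivial pp}}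

prime≢2⇒odd : ∀ {p} → Prime p → p ≢ 2 → ¬ 2 ∣ p
prime≢2⇒odd pp p≢2 2∣p with prime⇒irreducible pp 2∣p
... | inj₂ 2≡p = p≢2 (sym 2≡p)

odd⇒2t+1 : ∀ n → ¬ 2 ∣ n → ∃[ t ] n ≡ suc (2 * t)
odd⇒2t+1 zero          ¬2∣n = ⊥-elim (¬2∣n (divides 0 refl))
odd⇒2t+1 (suc zero)    _    = 0 , refl
odd⇒2t+1 (suc (suc n)) ¬2∣n with odd⇒2t+1 n (¬2∣n ∘ ∣m∣n⇒∣m+n ∣-refl)
... | t , refl = suc t , cong suc (sym (*-suc 2 t))

odd⇒nonZero : ∀ {k} → ¬ 2 ∣ k → NonZero k
odd⇒nonZero {zero}  ¬2∣0 = ⊥-elim (¬2∣0 (divides 0 refl))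
odd⇒nonZero {suc k} _    = _

even+odd : ∀ {a b} → 2 ∣ a → ¬ 2 ∣ b → ¬ 2 ∣ a + b
even+odd 2∣a ¬2∣b 2∣a+b = ¬2∣b (∣m+n∣m⇒∣n 2∣a+b 2∣a)

¬2∣1 : ¬ 2 ∣ 1
¬2∣1 2∣1 with () ← ∣1⇒≡1 2∣1

2∣2^ : ∀ a .{{_ : NonZero a}} → 2 ∣ 2 ^ a
2∣2^ (suc a) = m∣m*n (2 ^ a)

2^a∸1-odd : ∀ {M} a .{{_ : NonZero a}} → suc M ≡ 2 ^ a → ¬ 2 ∣ M
2^a∸1-odd {M} a eM 2∣M = ¬2∣1 (∣m+n∣m⇒∣n (subst (2 ∣_) (trans (sym eM) (+-comm 1 M)) (2∣2^ a)) 2∣M)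

suc[2^a∸1] : ∀ a → suc (2 ^ a ∸ 1) ≡ 2 ^ a
suc[2^a∸1] a = m+[n∸m]≡n (m^n>0 2 a)

∣∧<⇒≡0 : ∀ {M w} → M ∣ w → w < M → w ≡ 0
∣∧<⇒≡0 {w = zero}  _   _   = refl
∣∧<⇒≡0 {w = suc _} M∣w w<M = ⊥-elim (<⇒≱ w<M (∣⇒≤ M∣w))

^-distribʳ-* : ∀ x y k → (x * y) ^ k ≡ x ^ k * y ^ k
^-distribʳ-* x y zero    = refl
^-distribʳ-* x y (suc k) = begin
  x * y * (x * y) ^ k      ≡⟨ cong (x * y *_) (^-distribʳ-* x y k) ⟩
  x * y * (x ^ k * y ^ k)  ≡⟨ [m*n]*[o*p]≡[m*o]*[n*p] x y (x ^ k) (y ^ k) ⟩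
  x ^ suc k * y ^ suc k    ∎
  where open ≡-Reasoning

^-swap : ∀ x a b → (x ^ a) ^ b ≡ (x ^ b) ^ a
^-swap x a b = trans (^-*-assoc x a b) (trans (cong (x ^_) (*-comm a b)) (sym (^-*-assoc x b a)))

3+k≤2^k : ∀ k → 3 ≤ k → 3 + k ≤ 2 ^ k
3+k≤2^k (suc k) 3≤1+k with m≤n⇒m<n∨m≡n 3≤1+k
... | inj₂ refl    = m≤m+n 6 2
... | inj₁ 3<1+k = begin
  4 + k            ≤⟨ m≤m+n (4 + k) (2 + k) ⟩
  4 + k + (2 + k)  ≡⟨ solve 1 (λ k → con 4 :+ k :+ (con 2 :+ k) := con 2 :* (con 3 :+ k)) refl k ⟩
  2 * (3 + k)      ≤⟨ *-monoʳ-≤ 2 (3+k≤2^k k (≤-pred 3<1+k)) ⟩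
  2 * 2 ^ k        ∎
  where open ≤-Reasoning

^-monoʳ-∣ : ∀ x {a b} → a ≤ b → x ^ a ∣ x ^ b
^-monoʳ-∣ x {a} {b} a≤b = divides (x ^ (b ∸ a)) (begin
  x ^ b                ≡⟨ cong (x ^_) (m+[n∸m]≡n a≤b) ⟨
  x ^ (a + (b ∸ a))    ≡⟨ ^-distribˡ-+-* x a (b ∸ a) ⟩
  x ^ a * x ^ (b ∸ a)  ≡⟨ *-comm (x ^ a) (x ^ (b ∸ a)) ⟩
  x ^ (b ∸ a) * x ^ a  ∎)
  where open ≡-Reasoning

odd∣2x⇒∣x : ∀ {d x} → ¬ 2 ∣ d → d ∣ 2 * x → d ∣ x
odd∣2x⇒∣x ¬2∣d = coprime-divisor coprime-to-2
  where
  coprime-to-2 : Coprime _ 2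
  coprime-to-2 (e∣d , e∣2) with prime⇒irreducible prime[2] e∣2
  ... | inj₁ e≡1 = e≡1
  ... | inj₂ refl = ⊥-elim (¬2∣d e∣d)

prime^-cancel : ∀ {p} → Prime p → ∀ m {a Q} → ¬ p ∣ Q → p ^ m ∣ a * Q → p ^ m ∣ a
prime^-cancel pp zero    _    _ = 1∣ _
prime^-cancel {p} pp (suc m) {a} {Q} ¬p∣Q p^m+1∣aQ
  with euclidsLemma a Q pp (∣-trans (m∣m*n (p ^ m)) p^m+1∣aQ)
... | inj₂ p∣Q = ⊥-elim (¬p∣Q p∣Q)
... | inj₁ (divides e refl) = subst (p * p ^ m ∣_) (*-comm p e) (*-monoʳ-∣ p p^m∣e)
  where
  instance _ = prime⇒nonZero pp
  p^m∣eQ : p ^ m ∣ e * Q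
  p^m∣eQ = *-cancelˡ-∣ p (subst (p * p ^ m ∣_) (solve 3 (λ e p q → e :* p :* q := p :* (e :* q)) refl e p Q) p^m+1∣aQ)
  p^m∣e : p ^ m ∣ e
  p^m∣e = prime^-cancel pp m ¬p∣Q p^m∣eQ

2^a*odd-unique : ∀ a b {u v} → ¬ 2 ∣ u → ¬ 2 ∣ v → 2 ^ a * u ≡ 2 ^ b * v → a ≡ b
2^a*odd-unique zero    zero    _    _    _  = refl
2^a*odd-unique zero    (suc b) {u} {v} ¬2∣u _ eq =
  ⊥-elim (¬2∣u (subst (2 ∣_) (trans (sym eq) (*-identityˡ u)) (∣m⇒∣m*n v (m∣m*n (2 ^ b)))))
2^a*odd-unique (suc a) zero    {u} {v} _ ¬2∣v eq =
  ⊥-elim (¬2∣v (subst (2 ∣_) (trans eq (*-identityˡ v)) (∣m⇒∣m*n u (m∣m*n (2 ^ a)))))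
2^a*odd-unique (suc a) (suc b) {u} {v} ¬2∣u ¬2∣v eq = cong suc (2^a*odd-unique a b ¬2∣u ¬2∣v
  (*-cancelˡ-≡ (2 ^ a * u) (2 ^ b * v) 2 (trans (sym (*-assoc 2 (2 ^ a) u)) (trans eq (*-assoc 2 (2 ^ b) v)))))

geomSum : ℕ → ℕ → ℕ
geomSum x zero    = 1
geomSum x (suc m) = x ^ suc m + geomSum x m

-- (x − 1)(1 + x + ⋯ + x^m) = x^(m+1) − 1, stated for x = M + 1.
geomSum-closed : ∀ M m → M * geomSum (suc M) m + 1 ≡ suc M ^ suc m
geomSum-closed M zero    = solve 1 (λ M → M :* con 1 :+ con 1 := (con 1 :+ M) :* con 1) refl M
geomSum-closed M (suc m) = begin
  M * (X + geomSum (suc M) m) + 1    ≡⟨ solve 3 (λ M X G → M :* (X :+ G) :+ con 1 := M :* X :+ (M :* G :+ con 1)) refl M X (geomSum (suc M) m) ⟩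
  M * X + (M * geomSum (suc M) m + 1) ≡⟨ cong (M * X +_) (geomSum-closed M m) ⟩
  M * X + X                          ≡⟨ +-comm (M * X) X ⟩
  suc M * X                          ∎
  where open ≡-Reasoning
        X = suc M ^ suc m

geomSum-odd : ∀ {x} m → 2 ∣ x → ¬ 2 ∣ geomSum x m
geomSum-odd zero    _   = ¬2∣1
geomSum-odd {x} (suc m) 2∣x = even+odd (∣m⇒∣m*n (x ^ m) 2∣x) (geomSum-odd m 2∣x)

pow≡1-mod : ∀ M a → ∃[ s ] suc M ^ a ≡ 1 + M * s
pow≡1-mod M zero    = 0 , cong suc (sym (*-zeroʳ M))
pow≡1-mod M (suc a) with pow≡1-mod M a
... | s , eq = 1 + suc M * s , (begin
  suc M * suc M ^ a       ≡⟨ cong (suc M *_) eq ⟩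
  suc M * (1 + M * s)     ≡⟨ solve 2 (λ M s → (con 1 :+ M) :* (con 1 :+ M :* s) := con 1 :+ M :* (con 1 :+ (con 1 :+ M) :* s)) refl M s ⟩
  1 + M * (1 + suc M * s) ∎)
  where open ≡-Reasoning

-- Each term of geomSum (M + 1) m is ≡ 1 (mod M), so the sum is ≡ m + 1 (mod M).
geomSum≡m+1-mod : ∀ M m → ∃[ R ] geomSum (suc M) m ≡ M * R + suc m
geomSum≡m+1-mod M zero    = 0 , cong (_+ 1) (sym (*-zeroʳ M))
geomSum≡m+1-mod M (suc m) with pow≡1-mod M (suc m) | geomSum≡m+1-mod M m
... | s , eₛ | R , eᵣ = s + R , (begin
  suc M ^ suc m + geomSum (suc M) m ≡⟨ cong₂ _+_ eₛ eᵣ ⟩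
  1 + M * s + (M * R + suc m)       ≡⟨ solve 4 (λ M s R m → con 1 :+ M :* s :+ (M :* R :+ (con 1 :+ m)) := M :* (s :+ R) :+ (con 2 :+ m)) refl M s R m ⟩
  M * (s + R) + suc (suc m)         ∎)
  where open ≡-Reasoning

geomSum-not-divisible : ∀ M m → suc m < M → ¬ M ∣ geomSum (suc M) m
geomSum-not-divisible M m m+1<M M∣G with geomSum≡m+1-mod M m
... | R , eq = <⇒≱ m+1<M (∣⇒≤ (∣m+n∣m⇒∣n (subst (M ∣_) eq M∣G) (m∣m*n R)))

-- The order of 2 modulo 2^a − 1 is a: if 2^a − 1 ∣ 2^b − 1 with a ≥ 1, then a ∣ b.
-- Writing b = r + q·a with r < a, 2^b ≡ 2^r (mod 2^a − 1) and 2^r − 1 < 2^a − 1.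
mersenne-order : ∀ {M Y} a b .{{_ : NonZero a}} → suc M ≡ 2 ^ a → suc Y ≡ 2 ^ b → M ∣ Y → a ∣ b
mersenne-order {M} {Y} a b eM eY M∣Y = divides q (begin
  b          ≡⟨ m≡m%n+[m/n]*n b a ⟩
  r + q * a  ≡⟨ cong (_+ q * a) r≡0 ⟩
  q * a      ∎)
  where
  open ≡-Reasoning
  r = b % a
  q = b / a
  s = proj₁ (pow≡1-mod M q)
  w = pred (2 ^ r)
  1+w≡2^r : suc w ≡ 2 ^ r
  1+w≡2^r = suc-pred (2 ^ r) {{m^n≢0 2 r}}
  Y≡ : Y ≡ M * (2 ^ r * s) + w
  Y≡ = suc-injective (begin
    suc Y                    ≡⟨ eY ⟩
    2 ^ b                    ≡⟨ cong (2 ^_) (m≡m%n+[m/n]*n b a) ⟩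
    2 ^ (r + q * a)          ≡⟨ ^-distribˡ-+-* 2 r (q * a) ⟩
    2 ^ r * 2 ^ (q * a)      ≡⟨ cong (λ e → 2 ^ r * 2 ^ e) (*-comm q a) ⟩
    2 ^ r * 2 ^ (a * q)      ≡⟨ cong (2 ^ r *_) (^-*-assoc 2 a q) ⟨
    2 ^ r * (2 ^ a) ^ q      ≡⟨ cong (λ x → 2 ^ r * x ^ q) eM ⟨
    2 ^ r * suc M ^ q        ≡⟨ cong (2 ^ r *_) (proj₂ (pow≡1-mod M q)) ⟩
    2 ^ r * (1 + M * s)      ≡⟨ solve 3 (λ R M s → R :* (con 1 :+ M :* s) := M :* (R :* s) :+ R) refl (2 ^ r) M s ⟩
    M * (2 ^ r * s) + 2 ^ r  ≡⟨ cong (M * (2 ^ r * s) +_) 1+w≡2^r ⟨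
    M * (2 ^ r * s) + suc w  ≡⟨ +-suc (M * (2 ^ r * s)) w ⟩
    suc (M * (2 ^ r * s) + w) ∎)
  w≡0 : w ≡ 0
  w≡0 = ∣∧<⇒≡0 (∣m+n∣m⇒∣n (subst (M ∣_) Y≡ M∣Y) (m∣m*n _))
    (s<s⁻¹ (subst₂ _<_ (sym 1+w≡2^r) (sym eM) (^-monoʳ-< 2 (s≤s (s≤s z≤n)) (m%n<n b a))))
  r≡0 : r ≡ 0
  r≡0 with m^n≡1⇒n≡0∨m≡1 2 r (trans (sym 1+w≡2^r) (cong suc w≡0))
  ... | inj₁ r≡0 = r≡0

-- For odd x = q + 1 and odd exponent 2t + 1, 1 + x^(2t+1) = (1 + x)·Q with Q odd
-- (Q = x^(2t) − x^(2t−1) + ⋯ + 1 is an alternating sum of 2t + 1 odd terms).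
1+odd^odd : ∀ q → 2 ∣ q → ∀ t → ∃[ Q ] (1 + suc q ^ suc (2 * t) ≡ (1 + suc q) * Q × ¬ 2 ∣ Q)
1+odd^odd q 2∣q zero = 1 , solve 1 (λ q → con 1 :+ (con 1 :+ q) :* con 1 := (con 2 :+ q) :* con 1) refl q , ¬2∣1
1+odd^odd q 2∣q (suc t) with 1+odd^odd q 2∣q t
... | Q , eq , Q-odd = q * X + Q , (begin
  1 + x ^ suc (2 * suc t)          ≡⟨ cong (λ e → 1 + x ^ suc e) (*-suc 2 t) ⟩
  1 + x * (x * X)                  ≡⟨ solve 2 (λ q X → con 1 :+ (con 1 :+ q) :* ((con 1 :+ q) :* X)
                                                   := (con 2 :+ q) :* (q :* X) :+ (con 1 :+ X)) refl q X ⟩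
  (1 + x) * (q * X) + (1 + X)      ≡⟨ cong ((1 + x) * (q * X) +_) eq ⟩
  (1 + x) * (q * X) + (1 + x) * Q  ≡⟨ *-distribˡ-+ (1 + x) (q * X) Q ⟨
  (1 + x) * (q * X + Q)            ∎) , even+odd (∣m⇒∣m*n X 2∣q) Q-odd
  where
  open ≡-Reasoning
  x = suc q
  X = x ^ suc (2 * t)

2^m∣1+x^k⇔2^m∣1+x : ∀ m {x k} → ¬ 2 ∣ x → ¬ 2 ∣ k → 2 ^ m ∣ 1 + x ^ k ⇔ 2 ^ m ∣ 1 + x
2^m∣1+x^k⇔2^m∣1+x m {x} {k} ¬2∣x ¬2∣k with odd⇒2t+1 x ¬2∣x | odd⇒2t+1 k ¬2∣k
... | s , refl | t , refl with 1+odd^odd (2 * s) (m∣m*n s) t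
... | Q , eq , Q-odd = mk⇔
  (λ 2^m∣1+x^k → prime^-cancel prime[2] m Q-odd (subst (2 ^ m ∣_) eq 2^m∣1+x^k))
  (λ 2^m∣1+x → subst (2 ^ m ∣_) (sym eq) (∣m⇒∣m*n Q 2^m∣1+x))

∈-divisors⇔ : ∀ {n d} .{{_ : NonZero n}} → d ∈ divisors n ⇔ d ∣ n
∈-divisors⇔ {n} {d} = mk⇔ (proj₂ ∘ ∈-filter⁻ (_∣? n) {xs = map suc (upTo n)})
  (λ d∣n → ∈-filter⁺ (_∣? n) (candidate d d∣n) d∣n)
  where
  candidate : ∀ d → d ∣ n → d ∈ map suc (upTo n)
  candidate zero    0∣n = ⊥-elim (≢-nonZero⁻¹ n (0∣⇒≡0 0∣n))
  candidate (suc d) d∣n = ∈-map⁺ suc (∈-upTo⁺ (∣⇒≤ d∣n))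

divisors-unique : ∀ n → Unique (divisors n)
divisors-unique n = Unique.filter⁺ (_∣? n) (Unique.map⁺ suc-injective (Unique.upTo⁺ n))

divisorList : ℕ → ℕ → List ℕ
divisorList p zero    = 2 ^ 0 ∷ 2 ^ 0 * p ∷ []
divisorList p (suc m) = 2 ^ suc m ∷ 2 ^ suc m * p ∷ divisorList p m

DivisorShape : ℕ → ℕ → ℕ → Set
DivisorShape p m d = ∃[ a ] (a ≤ m × (d ≡ 2 ^ a ⊎ d ≡ 2 ^ a * p))

shape⇒∈ : ∀ {p d} m → DivisorShape p m d → d ∈ divisorList p m
shape⇒∈ zero (zero , _ , inj₁ refl) = here refl
shape⇒∈ zero (zero , _ , inj₂ refl) = there (here refl)
shape⇒∈ (suc m) (a , a≤1+m , d≡) with m≤n⇒m<n∨m≡n a≤1+m | d≡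
... | inj₂ refl | inj₁ refl = here refl
... | inj₂ refl | inj₂ refl = there (here refl)
... | inj₁ a<1+m | _        = there (there (shape⇒∈ m (a , ≤-pred a<1+m , d≡)))

∈⇒shape : ∀ {p d} m → d ∈ divisorList p m → DivisorShape p m d
∈⇒shape zero    (here refl)         = 0 , z≤n , inj₁ refl
∈⇒shape zero    (there (here refl)) = 0 , z≤n , inj₂ refl
∈⇒shape (suc m) (here refl)         = suc m , ≤-refl , inj₁ refl
∈⇒shape (suc m) (there (here refl)) = suc m , ≤-refl , inj₂ refl
∈⇒shape (suc m) (there (there d∈))  with ∈⇒shape m d∈
... | a , a≤m , d≡ = a , m≤n⇒m≤1+n a≤m , d≡

shape⇒∣ : ∀ {p d} m → DivisorShape p m d → d ∣ 2 ^ m * p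
shape⇒∣ m (a , a≤m , inj₁ refl) = ∣m⇒∣m*n _ (^-monoʳ-∣ 2 a≤m)
shape⇒∣ m (a , a≤m , inj₂ refl) = *-monoˡ-∣ _ (^-monoʳ-∣ 2 a≤m)

∣⇒shape : ∀ {p d} → Prime p → ∀ m → d ∣ 2 ^ m * p → DivisorShape p m d
∣⇒shape {p} {d} pp zero d∣p with prime⇒irreducible pp (subst (d ∣_) (*-identityˡ p) d∣p)
... | inj₁ refl = 0 , z≤n , inj₁ refl
... | inj₂ refl = 0 , z≤n , inj₂ (sym (*-identityˡ p))
∣⇒shape {p} {d} pp (suc m) d∣2x with 2 ∣? d
... | no ¬2∣d with ∣⇒shape pp m (odd∣2x⇒∣x ¬2∣d (subst (d ∣_) (*-assoc 2 (2 ^ m) p) d∣2x))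
...   | a , a≤m , d≡ = a , m≤n⇒m≤1+n a≤m , d≡
∣⇒shape {p} pp (suc m) d∣2x | yes (divides e refl)
  with ∣⇒shape {d = e} pp m (*-cancelʳ-∣ 2 (subst (e * 2 ∣_) (trans (*-assoc 2 (2 ^ m) p) (*-comm 2 (2 ^ m * p))) d∣2x))
... | a , a≤m , inj₁ refl = suc a , s≤s a≤m , inj₁ (*-comm (2 ^ a) 2)
... | a , a≤m , inj₂ refl = suc a , s≤s a≤m , inj₂ (solve 2 (λ x p → x :* p :* con 2 := con 2 :* x :* p) refl (2 ^ a) p)

∈-divisorList⇔ : ∀ {p d} → Prime p → ∀ m → d ∈ divisorList p m ⇔ d ∣ 2 ^ m * p
∈-divisorList⇔ pp m = mk⇔ (shape⇒∣ m ∘ ∈⇒shape m) (shape⇒∈ m ∘ ∣⇒shape pp m)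

2^a≢2^a*p : ∀ {p} a → 1 < p → 2 ^ a ≢ 2 ^ a * p
2^a≢2^a*p {p} a 1<p eq = <⇒≢ 1<p (*-cancelˡ-≡ 1 p (2 ^ a) {{m^n≢0 2 a}} (trans (*-identityʳ (2 ^ a)) eq))

2^1+m∤2^m*p : ∀ {p} m → ¬ 2 ∣ p → ¬ 2 ^ suc m ∣ 2 ^ m * p
2^1+m∤2^m*p {p} m ¬2∣p 2^1+m∣ = ¬2∣p (*-cancelˡ-∣ (2 ^ m) {{m^n≢0 2 m}} (subst (_∣ 2 ^ m * p) (*-comm 2 (2 ^ m)) 2^1+m∣))

-- The entries of divisorList are distinct: the two new entries 2^(m+1), 2^(m+1)·p
-- are divisible by 2^(m+1), unlike every divisor of 2^m·p.
divisorList-unique : ∀ {p} → Prime p → ¬ 2 ∣ p → ∀ m → Unique (divisorList p m)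
divisorList-unique pp ¬2∣p zero    = (2^a≢2^a*p 0 (prime>1 pp) ∷ []) ∷ [] ∷ []
divisorList-unique {p} pp ¬2∣p (suc m) =
  (2^a≢2^a*p (suc m) (prime>1 pp) ∷ tabulate (λ d∈ 2^1+m≡d → not-old d∈ (subst (2 ^ suc m ∣_) 2^1+m≡d ∣-refl)))
  ∷ tabulate (λ d∈ 2^1+m*p≡d → not-old d∈ (subst (2 ^ suc m ∣_) 2^1+m*p≡d (m∣m*n p)))
  ∷ divisorList-unique pp ¬2∣p m
  where
  not-old : ∀ {d} → d ∈ divisorList p m → ¬ 2 ^ suc m ∣ d
  not-old d∈ 2^1+m∣d = 2^1+m∤2^m*p m ¬2∣p (∣-trans 2^1+m∣d (to (∈-divisorList⇔ pp m) d∈))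

-- Being duplicate-free with the same members, the two lists are permutations of each other.
divisors↭divisorList : ∀ {p} → Prime p → ¬ 2 ∣ p → ∀ m → divisors (2 ^ m * p) ↭ divisorList p m
divisors↭divisorList {p} pp ¬2∣p m = ∼bag⇒↭ (unique∧set⇒bag (divisors-unique (2 ^ m * p)) (divisorList-unique pp ¬2∣p m)
  (⇔.trans (∈-divisors⇔ {2 ^ m * p} {{2^m*p≢0}}) (⇔.sym (∈-divisorList⇔ pp m))))
  where
  2^m*p≢0 : NonZero (2 ^ m * p)
  2^m*p≢0 = m*n≢0 (2 ^ m) p {{m^n≢0 2 m}} {{prime⇒nonZero pp}}

σ-pair : ∀ p k a → (2 ^ a) ^ k + (2 ^ a * p) ^ k ≡ (2 ^ k) ^ a * (1 + p ^ k)
σ-pair p k a = begin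
  (2 ^ a) ^ k + (2 ^ a * p) ^ k       ≡⟨ cong ((2 ^ a) ^ k +_) (^-distribʳ-* (2 ^ a) p k) ⟩
  (2 ^ a) ^ k + (2 ^ a) ^ k * p ^ k   ≡⟨ *-suc ((2 ^ a) ^ k) (p ^ k) ⟨
  (2 ^ a) ^ k * (1 + p ^ k)            ≡⟨ cong (_* (1 + p ^ k)) (^-swap 2 a k) ⟩
  (2 ^ k) ^ a * (1 + p ^ k)            ∎
  where open ≡-Reasoning

sum-divisorList : ∀ p k m → sum (map (_^ k) (divisorList p m)) ≡ geomSum (2 ^ k) m * (1 + p ^ k)
sum-divisorList p k zero    = trans (sym (+-assoc ((2 ^ 0) ^ k) ((2 ^ 0 * p) ^ k) 0))
  (trans (+-identityʳ _) (σ-pair p k 0))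
sum-divisorList p k (suc m) = begin
  A + (B + rest)                                ≡⟨ +-assoc A B rest ⟨
  A + B + rest                                  ≡⟨ cong₂ _+_ (σ-pair p k (suc m)) (sum-divisorList p k m) ⟩
  (2 ^ k) ^ suc m * P + geomSum (2 ^ k) m * P   ≡⟨ *-distribʳ-+ P ((2 ^ k) ^ suc m) (geomSum (2 ^ k) m) ⟨
  geomSum (2 ^ k) (suc m) * P                   ∎
  where
  open ≡-Reasoning
  A = (2 ^ suc m) ^ k
  B = (2 ^ suc m * p) ^ k
  rest = sum (map (_^ k) (divisorList p m))
  P = 1 + p ^ k

σ-2^m*p : ∀ {p} → Prime p → ¬ 2 ∣ p → ∀ k m → σ k (2 ^ m * p) ≡ geomSum (2 ^ k) m * (1 + p ^ k)
σ-2^m*p {p} pp ¬2∣p k m = trans (sum-↭ (Perm.map⁺ (_^ k) (divisors↭divisorList pp ¬2∣p m))) (sum-divisorList p k m)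

prime∤1+p^k : ∀ {p} k .{{_ : NonZero k}} → Prime p → ¬ p ∣ 1 + p ^ k
prime∤1+p^k {p} (suc k) pp p∣1+p^k = <⇒≢ (prime>1 pp)
  (sym (∣1⇒≡1 (∣m+n∣m⇒∣n (subst (p ∣_) (+-comm 1 (p ^ suc k)) p∣1+p^k) (m∣m*n (p ^ k)))))

-- Since σ_k(2^m·p) = S·(1 + p^k) with S odd and p ∤ 1 + p^k, the factors 2^m and p
-- must go into 1 + p^k and S respectively.
σ-divisible⇔ : ∀ {p k} m → Prime p → ¬ 2 ∣ p → ¬ 2 ∣ k →
  2 ^ m * p ∣ σ k (2 ^ m * p) ⇔ (2 ^ m ∣ 1 + p × p ∣ geomSum (2 ^ k) m)
σ-divisible⇔ {p} {k} m pp ¬2∣p ¬2∣k rewrite σ-2^m*p pp ¬2∣p k m = mk⇔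
  (λ n∣SP → to 2-part (prime^-cancel prime[2] m S-odd (subst (2 ^ m ∣_) (*-comm S P) (∣-trans (m∣m*n p) n∣SP)))
          , [ id , ⊥-elim ∘ prime∤1+p^k k pp ]′ (euclidsLemma S P pp (∣-trans (n∣m*n (2 ^ m)) n∣SP)))
  (λ (2^m∣1+p , p∣S) → subst (2 ^ m * p ∣_) (*-comm P S) (*-pres-∣ (from 2-part 2^m∣1+p) p∣S))
  where
  instance _ = odd⇒nonZero ¬2∣k
  S = geomSum (2 ^ k) m
  P = 1 + p ^ k
  S-odd : ¬ 2 ∣ S
  S-odd = geomSum-odd m (2∣2^ k)
  2-part : 2 ^ m ∣ 1 + p ^ k ⇔ 2 ^ m ∣ 1 + p
  2-part = 2^m∣1+x^k⇔2^m∣1+x m ¬2∣p ¬2∣k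

small-multiple : ∀ m {x} → 2 ^ m ∣ x → 0 < x → x < 3 * 2 ^ m → x ≡ 2 ^ m ⊎ x ≡ 2 ^ suc m
small-multiple m (divides 1 refl) _ _ = inj₁ (+-identityʳ (2 ^ m))
small-multiple m (divides 2 refl) _ _ = inj₂ refl
small-multiple m (divides (suc (suc (suc c))) refl) _ x<3·2^m
  with s≤s (s≤s (s≤s ())) ← *-cancelʳ-< (2 ^ m) (3 + c) 3 x<3·2^m

mersenne-exponent : ∀ {p} a → Prime p → suc p ≡ 2 ^ a → 1 < a
mersenne-exponent zero          pp refl with () ← prime>1 pp
mersenne-exponent (suc zero)    pp refl with s≤s () ← prime>1 pp
mersenne-exponent (suc (suc a)) _  _    = s≤s (s≤s z≤n)

mersenne-geomSum : ∀ {M} k m → suc M ≡ 2 ^ k → M * geomSum (2 ^ k) m + 1 ≡ 2 ^ (k * suc m)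
mersenne-geomSum {M} k m eM = begin
  M * geomSum (2 ^ k) m + 1  ≡⟨ cong (λ x → M * geomSum x m + 1) eM ⟨
  M * geomSum (suc M) m + 1  ≡⟨ geomSum-closed M m ⟩
  suc M ^ suc m              ≡⟨ cong (_^ suc m) eM ⟩
  (2 ^ k) ^ suc m            ≡⟨ ^-*-assoc 2 k (suc m) ⟩
  2 ^ (k * suc m)            ∎
  where open ≡-Reasoning

-- 2^k − 1 ∤ 1 + 2^k + ⋯ + 2^(kj) when k ≥ 3 and j ≤ k: the sum is ≡ j + 1 (mod 2^k − 1)
-- and 0 < j + 1 < 2^k − 1.
mersenne∤geomSum : ∀ {M k j} → suc M ≡ 2 ^ k → 2 < k → j ≤ k → ¬ M ∣ geomSum (2 ^ k) j
mersenne∤geomSum {M} {k} {j} eM 2<k j≤k = subst (λ x → ¬ M ∣ geomSum x j) eM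
  (geomSum-not-divisible M j (≤-trans (s≤s (s≤s j≤k)) (≤-pred (subst (3 + k ≤_) (sym eM) (3+k≤2^k k 2<k)))))

-- A Mersenne prime p = 2^m − 1 never divides 1 + 2^k + ⋯ + 2^(km) (k ≥ 3 prime):
-- otherwise p ∣ 2^(k(m+1)) − 1, so m ∣ k(m+1), hence m ∣ k, i.e. m = k, and then
-- p = 2^k − 1 cannot divide the sum.
mersenne-short : ∀ {p k} m → suc p ≡ 2 ^ m → Prime p → Prime k → 2 < k → ¬ p ∣ geomSum (2 ^ k) m
mersenne-short {p} {k} m ep pp pk 2<k p∣S = [ <⇒≢ (mersenne-exponent m pp ep) ∘ sym
  , (λ m≡k → mersenne∤geomSum (trans ep (cong (2 ^_) m≡k)) 2<k (≤-reflexive m≡k) p∣S) ]′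
  (prime⇒irreducible pk m∣k)
  where
  instance _ = >-nonZero (<⇒≤ (mersenne-exponent m pp ep))
  M = 2 ^ k ∸ 1
  m∣k[m+1] : m ∣ k * suc m
  m∣k[m+1] = mersenne-order m (k * suc m) ep
    (trans (+-comm 1 (M * geomSum (2 ^ k) m)) (mersenne-geomSum k m (suc[2^a∸1] k)))
    (∣-trans p∣S (n∣m*n M))
  m∣k : m ∣ k
  m∣k = ∣m+n∣m⇒∣n (subst (m ∣_) (trans (*-suc k m) (+-comm k (k * m))) m∣k[m+1]) (n∣m*n k)

-- The sum times 2^k − 1 is
-- 2^(k(m+1)) − 1 = (p + 1)^k − 1 ≡ 0 (mod p), and p ∣ 2^k − 1 would force m + 1 ∣ k.
mersenne-long⇔ : ∀ {p k} m → suc p ≡ 2 ^ suc m → Prime p → Prime k → 2 < k →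
  p ∣ geomSum (2 ^ k) m ⇔ suc m ≢ k
mersenne-long⇔ {p} {k} m ep pp pk 2<k = mk⇔
  (λ p∣S 1+m≡k → mersenne∤geomSum (trans ep (cong (2 ^_) 1+m≡k)) 2<k (≤-trans (n≤1+n m) (≤-reflexive 1+m≡k)) p∣S)
  (λ 1+m≢k → [ ⊥-elim ∘ p∤M 1+m≢k , id ]′ (euclidsLemma M S pp p∣MS))
  where
  open ≡-Reasoning
  M = 2 ^ k ∸ 1
  S = geomSum (2 ^ k) m
  s = proj₁ (pow≡1-mod p k)
  MS≡ps : M * S ≡ p * s
  MS≡ps = +-cancelʳ-≡ 1 (M * S) (p * s) (begin
    M * S + 1         ≡⟨ mersenne-geomSum k m (suc[2^a∸1] k) ⟩
    2 ^ (k * suc m)   ≡⟨ cong (2 ^_) (*-comm k (suc m)) ⟩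
    2 ^ (suc m * k)   ≡⟨ ^-*-assoc 2 (suc m) k ⟨
    (2 ^ suc m) ^ k   ≡⟨ cong (_^ k) ep ⟨
    suc p ^ k         ≡⟨ proj₂ (pow≡1-mod p k) ⟩
    1 + p * s         ≡⟨ +-comm 1 (p * s) ⟩
    p * s + 1         ∎)
  p∣MS : p ∣ M * S
  p∣MS = divides s (trans MS≡ps (*-comm p s))
  p∤M : suc m ≢ k → ¬ p ∣ M
  p∤M 1+m≢k p∣M with prime⇒irreducible pk (mersenne-order (suc m) k ep (suc[2^a∸1] k) p∣M)
  ... | inj₁ 1+m≡1 = <⇒≢ (mersenne-exponent (suc m) pp ep) (sym 1+m≡1)
  ... | inj₂ 1+m≡k = 1+m≢k 1+m≡k

-- For an odd prime p, 2^m·p is perfect iff p = 2^(m+1) − 1.  With B = 1 + 2 + ⋯ + 2^m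
-- = 2^(m+1) − 1, perfection reads B·(1 + p) = (B + 1)·p, i.e. B = p.
perfect⇔ : ∀ {p} m → Prime p → ¬ 2 ∣ p → Perfect (2 ^ m * p) ⇔ suc p ≡ 2 ^ suc m
perfect⇔ {p} m pp ¬2∣p = mk⇔
  (λ (_ , σ≡2n) → trans (cong suc (sym (B≡p (trans (sym (σ-2^m*p pp ¬2∣p 1 m)) σ≡2n)))) 1+B≡2^[m+1])
  (λ ep → *-mono-≤ (m^n>0 2 m) (<⇒≤ (prime>1 pp)) , perfect ep)
  where
  open ≡-Reasoning
  B = geomSum 2 m
  1+B≡2^[m+1] : suc B ≡ 2 ^ suc m
  1+B≡2^[m+1] = trans (+-comm 1 B) (trans (cong (_+ 1) (sym (*-identityˡ B))) (geomSum-closed 1 m))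
  B≡p : B * (1 + p ^ 1) ≡ 2 * (2 ^ m * p) → B ≡ p
  B≡p eq = +-cancelʳ-≡ (B * p) B p (begin
    B + B * p        ≡⟨ solve 2 (λ B p → B :+ B :* p := B :* (con 1 :+ p :* con 1)) refl B p ⟩
    B * (1 + p ^ 1)  ≡⟨ eq ⟩
    2 * (2 ^ m * p)  ≡⟨ *-assoc 2 (2 ^ m) p ⟨
    2 ^ suc m * p    ≡⟨ cong (_* p) 1+B≡2^[m+1] ⟨
    suc B * p        ∎)
  perfect : suc p ≡ 2 ^ suc m → σ 1 (2 ^ m * p) ≡ 2 * (2 ^ m * p)
  perfect ep = begin
    σ 1 (2 ^ m * p)  ≡⟨ σ-2^m*p pp ¬2∣p 1 m ⟩
    B * (1 + p ^ 1)  ≡⟨ cong₂ (λ b x → b * suc x) (suc-injective (trans 1+B≡2^[m+1] (sym ep))) (*-identityʳ p) ⟩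
    p * suc p        ≡⟨ cong (p *_) ep ⟩
    p * 2 ^ suc m    ≡⟨ solve 2 (λ p x → p :* (con 2 :* x) := con 2 :* (x :* p)) refl p (2 ^ m) ⟩
    2 * (2 ^ m * p)  ∎

-- When p = 2^(m+1) − 1, the number 2^m·p equals 2^(k−1)(2^k − 1) exactly when m + 1 = k,
-- by uniqueness of the decomposition into a power of 2 and an odd factor.
excluded⇔ : ∀ {p} m k .{{_ : NonZero k}} → suc p ≡ 2 ^ suc m →
  2 ^ m * p ≡ 2 ^ (k ∸ 1) * (2 ^ k ∸ 1) ⇔ suc m ≡ k
excluded⇔ {p} m (suc k) ep = mk⇔
  (cong suc ∘ 2^a*odd-unique m k (2^a∸1-odd (suc m) ep) (2^a∸1-odd (suc k) (suc[2^a∸1] (suc k))))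
  (λ { refl → cong (λ x → 2 ^ m * (x ∸ 1)) ep })

σ-divisible⇔criterion : ∀ {p k} m → Prime p → ¬ 2 ∣ p → Prime k → 2 < k → suc p < 3 * 2 ^ m →
  2 ^ m * p ∣ σ k (2 ^ m * p) ⇔ (suc p ≡ 2 ^ suc m × suc m ≢ k)
σ-divisible⇔criterion {p} {k} m pp ¬2∣p pk 2<k 1+p<3·2^m =
  ⇔.trans (σ-divisible⇔ m pp ¬2∣p (prime≢2⇒odd pk (>⇒≢ 2<k))) (mk⇔ criterion-holds criterion-suffices)
  where
  criterion-holds : 2 ^ m ∣ 1 + p × p ∣ geomSum (2 ^ k) m → suc p ≡ 2 ^ suc m × suc m ≢ k
  criterion-holds (2^m∣1+p , p∣S) with small-multiple m 2^m∣1+p z<s 1+p<3·2^m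
  ... | inj₁ ep = ⊥-elim (mersenne-short m ep pp pk 2<k p∣S)
  ... | inj₂ ep = ep , to (mersenne-long⇔ m ep pp pk 2<k) p∣S
  criterion-suffices : suc p ≡ 2 ^ suc m × suc m ≢ k → 2 ^ m ∣ 1 + p × p ∣ geomSum (2 ^ k) m
  criterion-suffices (ep , 1+m≢k) = divides 2 ep , from (mersenne-long⇔ m ep pp pk 2<k) 1+m≢k

perfect⇔criterion : ∀ {p} m k .{{_ : NonZero m}} .{{_ : NonZero k}} → Prime p → ¬ 2 ∣ p →
  ((2 ∣ 2 ^ m * p) × Perfect (2 ^ m * p) × 2 ^ m * p ≢ 2 ^ (k ∸ 1) * (2 ^ k ∸ 1))
    ⇔ (suc p ≡ 2 ^ suc m × suc m ≢ k)
perfect⇔criterion {p} m k pp ¬2∣p = mk⇔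
  (λ (_ , n-perfect , n≢) → let ep = to (perfect⇔ m pp ¬2∣p) n-perfect in ep , n≢ ∘ from (excluded⇔ m k ep))
  (λ (ep , 1+m≢k) → ∣m⇒∣m*n p (2∣2^ m) , from (perfect⇔ m pp ¬2∣p) ep , 1+m≢k ∘ to (excluded⇔ m k ep))

<∸1⇒1+< : ∀ {p} x → p < x ∸ 1 → suc p < x
<∸1⇒1+< zero    ()
<∸1⇒1+< (suc x) p<x = s≤s p<x

-- Theorem 1.3.  Both sides are equivalent to "p = 2^α − 1 and α ≠ k".
theorem1p3 : (k : ℕ) → 2 < k → Prime k → Prime (2 ^ k ∸ 1) →
    (α p : ℕ) → 1 < α → Prime p → ¬ (2 ∣ p) → p < 3 * 2 ^ (α ∸ 1) ∸ 1 →
    (2 ^ (α ∸ 1) * p ∣ σ k (2 ^ (α ∸ 1) * p)) ⇔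
    ((2 ∣ 2 ^ (α ∸ 1) * p) × Perfect (2 ^ (α ∸ 1) * p)
    × 2 ^ (α ∸ 1) * p ≢ 2 ^ (k ∸ 1) * (2 ^ k ∸ 1))
theorem1p3 k 2<k pk _ (suc m) p (s≤s 1≤m) pp ¬2∣p p<3·2^m∸1 =
  ⇔.trans (σ-divisible⇔criterion m pp ¬2∣p pk 2<k (<∸1⇒1+< (3 * 2 ^ m) p<3·2^m∸1))
          (⇔.sym (perfect⇔criterion m k pp ¬2∣p))
  where
  instance
    m≢0 : NonZero m
    m≢0 = >-nonZero 1≤m
    k≢0 : NonZero k
    k≢0 = >-nonZero (<-trans z<s 2<k)
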